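{- Let $D_5=(V,E)$ be the graph obtained from the dodecahedron graph by subdividing every edge with five new vertices of degree $2$ (so every original edge becomes a path with $6$ edges). Consider the following game on $D_5$: two cops and one robber occupy vertices of $D_5$; the cops first choose their starting vertices, then the robber, seeing them, chooses his starting vertex; then the players alternate turns, cops first, where in a turn each cop (respectively the robber) either stays at its current vertex or moves along an edge to an adjacent vertex. Then the robber has a strategy that guarantees that at all times the graph distance in $D_5$ between the robber and each of the two cops is at least $2$. Moreover, this holds even under the additional restriction that each time the robber moves onto a vertex $v$ of degree $3$, he must announce, before seeing the cops' next move, to which neighbor of $v$ he will move in his next turn.
   Context: The dodecahedron graph is the $3$-regular planar graph with $20$ vertices and $30$ edges forming the $1$-skeleton of the regular dodecahedron. Both players have complete information. -}

module Defs where

open import Data.Bool using (Bool; true; false; _∧_; _∨_; T)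
open import Data.Nat using (ℕ; zero; suc; _<_)
import Data.Nat as ℕ
open import Data.Fin using (Fin; toℕ; fromℕ)
import Data.Fin as F
open import Data.Fin.Properties using (_≟_)
open import Data.Product using (_×_; _,_; proj₁; proj₂; Σ)
open import Data.Sum using (_⊎_; inj₁; inj₂)
open import Data.List using (List; length; filterᵇ; allFin; map; _++_; cartesianProduct)
open import Data.Vec using (Vec; tabulate; lookup; []; _∷_)
open import Relation.Nullary using (¬_)
open import Relation.Nullary.Decidable using (⌊_⌋)
open import Relation.Binary.PropositionalEquality using (_≡_; _≢_)

-- The dodecahedron graph, realised as the generalised Petersen graph
-- GP(10,2): outer vertices 0..9 (cycle i -- i+1 mod 10), inner vertices
-- 10..19 (spokes i -- 10+i, inner edges 10+i -- 10+(i+2 mod 10)).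
-- 20 vertices, 30 edges, 3-regular, planar: the dodecahedron skeleton.

dodecaEdges : Vec (ℕ × ℕ) 30
dodecaEdges =
  (0 , 1) ∷ (1 , 2) ∷ (2 , 3) ∷ (3 , 4) ∷ (4 , 5) ∷
  (5 , 6) ∷ (6 , 7) ∷ (7 , 8) ∷ (8 , 9) ∷ (9 , 0) ∷
  (0 , 10) ∷ (1 , 11) ∷ (2 , 12) ∷ (3 , 13) ∷ (4 , 14) ∷
  (5 , 15) ∷ (6 , 16) ∷ (7 , 17) ∷ (8 , 18) ∷ (9 , 19) ∷
  (10 , 12) ∷ (11 , 13) ∷ (12 , 14) ∷ (13 , 15) ∷ (14 , 16) ∷
  (15 , 17) ∷ (16 , 18) ∷ (17 , 19) ∷ (18 , 10) ∷ (19 , 11) ∷ []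

tail head : Fin 30 → ℕ
tail e = proj₁ (lookup dodecaEdges e)
head e = proj₂ (lookup dodecaEdges e)

-- D₅: every edge e = (tail e, head e) is replaced by the path
--   tail e -- sub e 0 -- sub e 1 -- sub e 2 -- sub e 3 -- sub e 4 -- head e
-- (five new vertices of degree 2, six edges).

V : Set
V = Fin 20 ⊎ (Fin 30 × Fin 5)

allV : List V
allV = map inj₁ (allFin 20) ++ map inj₂ (cartesianProduct (allFin 30) (allFin 5))

_==_ : ℕ → ℕ → Bool
m == n = ⌊ m ℕ.≟ n ⌋

adj : V → V → Bool
adj (inj₁ a) (inj₁ b) = false
adj (inj₁ a) (inj₂ (e , j)) =
  ((toℕ j == 0) ∧ (toℕ a == tail e)) ∨ ((toℕ j == 4) ∧ (toℕ a == head e))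
adj (inj₂ (e , j)) (inj₁ a) =
  ((toℕ j == 0) ∧ (toℕ a == tail e)) ∨ ((toℕ j == 4) ∧ (toℕ a == head e))
adj (inj₂ (e , j)) (inj₂ (e' , j')) =
  ⌊ e ≟ e' ⌋ ∧ ((toℕ j' == suc (toℕ j)) ∨ (toℕ j == suc (toℕ j')))

Adj : V → V → Set
Adj u v = T (adj u v)

degree : V → ℕ
degree v = length (filterᵇ (adj v) allV)

-- Graph distance: Walk u v n = walk with exactly n edges from u to v.
-- dist(u,v) ≥ 2  iff  there is no walk of length < 2 from u to v.

data Walk : V → V → ℕ → Set where
  here : ∀ {u} → Walk u u 0
  step : ∀ {u v w n} → Adj u v → Walk v w n → Walk u w (suc n)

DistAtLeast2 : V → V → Set
DistAtLeast2 u v = ∀ n → n < 2 → ¬ Walk u v n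

Step : V → V → Set
Step u v = u ≡ v ⊎ Adj u v

-- Cop positions (both cops) form a sequence c : ℕ → V × V:
-- c 0 = the cops' starting vertices, c (suc k) = positions after the
-- cops' (k+1)-st turn.  The robber's position r k is chosen after seeing
-- c 0 , … , c k  (r 0 = starting vertex, r (suc k) = after his
-- (k+1)-st turn).

Cops : Set
Cops = V × V

Cops-seq : Set
Cops-seq = ℕ → Cops

prefix : (ℕ → Cops) → (n : ℕ) → Vec Cops (suc n)
prefix c n = tabulate (λ i → c (toℕ i))

-- A robber strategy: next position, and an announced vertex, both as a
-- function of everything seen so far (the cops' positions c 0 … c n;
-- the robber's own earlier positions are determined by these).
-- `announce n h` is the neighbour announced at the moment the robber has
-- just made his n-th move (before the cops' next move is seen).
record RobberStrategy : Set where
  field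
    pos      : (n : ℕ) → Vec Cops (suc n) → V
    announce : (n : ℕ) → Vec Cops (suc n) → V

open RobberStrategy public

LegalCops : (ℕ → Cops) → Set
LegalCops c = ∀ k → Step (proj₁ (c k)) (proj₁ (c (suc k)))
                  × Step (proj₂ (c k)) (proj₂ (c (suc k)))

robberAt : RobberStrategy → (ℕ → Cops) → ℕ → V
robberAt σ c k = pos σ k (prefix c k)

announcedAt : RobberStrategy → (ℕ → Cops) → ℕ → V
announcedAt σ c k = announce σ k (prefix c k)

RobberLegal : RobberStrategy → (ℕ → Cops) → Set
RobberLegal σ c = ∀ k → Step (robberAt σ c k) (robberAt σ c (suc k))

-- at all times, robber at distance ≥ 2 from both cops:
-- after the robber's k-th move (cops at c k) and after the cops'
-- following move (cops at c (suc k)).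
SafeFromCops : V → Cops → Set
SafeFromCops r (c₁ , c₂) = DistAtLeast2 r c₁ × DistAtLeast2 r c₂

AlwaysSafe : RobberStrategy → (ℕ → Cops) → Set
AlwaysSafe σ c = ∀ k → SafeFromCops (robberAt σ c k) (c k)
                     × SafeFromCops (robberAt σ c k) (c (suc k))

RespectsAnnouncements : RobberStrategy → (ℕ → Cops) → Set
RespectsAnnouncements σ c = ∀ k →
  robberAt σ c k ≢ robberAt σ c (suc k) →
  degree (robberAt σ c (suc k)) ≡ 3 →
  Adj (robberAt σ c (suc k)) (announcedAt σ c (suc k))
  × robberAt σ c (suc (suc k)) ≡ announcedAt σ c (suc k)

-- The robber runs along the subdivided edges without ever stopping and, at
-- each branch vertex, enters an edge whose far end he is sure to reach
-- first: he keeps the invariant that he is at least three steps closer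
-- than either cop to the branch vertex he is heading for.  Reaching it, the
-- cops are still at distance at least 3 from it, and since every cycle of
-- D₅ has length at least 30, a cop that far away is within distance 8 of
-- at most one of its three neighbours; of the three exits one is therefore
-- at distance at least 9 = 3 + 6 from both cops.  A margin of 3 before the
-- cops move and of 2 after it keeps the robber at distance at least 2.
module Submission where

open import Defs
open import Data.Bool using (Bool; true; false; _∧_; T)
open import Data.Bool.Properties using (T-∧; T-∨)
open import Data.Empty using (⊥-elim)
open import Data.Fin using (Fin; zero; suc; toℕ; fromℕ; fromℕ<; inject₁; _↑ˡ_; opposite; #_)
open import Data.Fin.Properties using (toℕ-injective; toℕ-fromℕ<; toℕ-fromℕ; toℕ-inject₁; all?; any?; _≟_)
open import Data.Fin.Relation.Unary.Top using (view; ‵fromℕ; ‵inject₁)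
open import Data.Nat using (ℕ; zero; suc; _+_; _*_; _∸_; _⊓_; _≤_; _<_; z≤n; s≤s; _≤ᵇ_; _≤?_; _<?_)
import Data.Nat as ℕ
open import Data.Nat.Properties
  using (≤ᵇ⇒≤; ≤-refl; ≤-trans; ≤-pred; n≤1+n; 1+n≰n; +-monoˡ-≤; +-monoʳ-≤; ∸-monoʳ-≤;
         ⊓-mono-≤; m≤n⇒m⊓n≡m; m≥n⇒m⊓n≡n; n∸n≡0)
open import Data.Product using (Σ; ∃; ∃-syntax; _×_; _,_; proj₁; proj₂; map₂; swap)
import Data.Product.Properties as Product
open import Data.Sum using (_⊎_; inj₁; inj₂; [_,_]′; fromInj₂)
import Data.Sum.Properties as Sum
open import Data.Unit using (tt)
open import Data.Vec using (Vec; []; _∷_; lookup)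
open import Data.Vec.Properties using (lookup∘tabulate)
open import Function using (_∘_; Equivalence)
open import Relation.Binary.Definitions using (DecidableEquality)
open import Relation.Binary.PropositionalEquality
  using (_≡_; _≢_; refl; sym; trans; cong; cong₂; subst; subst₂; module ≡-Reasoning)
open import Relation.Nullary using (Dec; yes; no; ¬_; ¬?)
open import Relation.Nullary.Decidable using (toWitness; map′; T?; _×-dec_; _⊎-dec_; _→-dec_)

open Equivalence using (to; from)

AtMostOneFailure : ∀ {n} → (Fin n → Bool) → Set
AtMostOneFailure f = ∀ i j → i ≢ j → T (f i) ⊎ T (f j)

atMostOneFailure? : ∀ {n} (f : Fin n → Bool) → Dec (AtMostOneFailure f)
atMostOneFailure? f = all? λ i → all? λ j → ¬? (i ≟ j) →-dec (T? (f i) ⊎-dec T? (f j))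

commonSuccess-failing₀ : ∀ {n} {f g : Fin (3 + n) → Bool} → ¬ T (f zero) →
                         AtMostOneFailure f → AtMostOneFailure g → ∃[ i ] T (f i) × T (g i)
commonSuccess-failing₀ ¬f₀ hf hg =
  [ (λ g₁ → # 1 , f₁ , g₁) , (λ g₂ → # 2 , f₂ , g₂) ]′ (hg (# 1) (# 2) λ ())
  where
  f₁ = fromInj₂ (⊥-elim ∘ ¬f₀) (hf zero (# 1) λ ())
  f₂ = fromInj₂ (⊥-elim ∘ ¬f₀) (hf zero (# 2) λ ())

commonSuccess : ∀ {n} {f g : Fin (3 + n) → Bool} →
                AtMostOneFailure f → AtMostOneFailure g → ∃[ i ] T (f i) × T (g i)
commonSuccess {f = f} {g} hf hg with T? (f zero) | T? (g zero)
... | yes f₀ | yes g₀ = zero , f₀ , g₀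
... | no ¬f₀ | _      = commonSuccess-failing₀ ¬f₀ hf hg
... | yes _  | no ¬g₀ = map₂ swap (commonSuccess-failing₀ ¬g₀ hg hf)

search : ∀ {n} → (Fin (suc n) → Bool) → Fin (suc n)
search f with any? (T? ∘ f)
... | yes (i , _) = i
... | no _        = zero

search-sound : ∀ {n} (f : Fin (suc n) → Bool) → ∃ (T ∘ f) → T (f (search f))
search-sound f ∃fi with any? (T? ∘ f)
... | yes (_ , fi) = fi
... | no ∄fi       = ⊥-elim (∄fi ∃fi)

-- The distance from the k-th vertex of a path of length n to a vertex outside
-- it at distances p and q from the two ends of the path.
pathDist : ℕ → ℕ → ℕ → ℕ → ℕ
pathDist n p q k = (k + p) ⊓ ((n ∸ k) + q)

Within : ℕ → ℕ → ℕ → Set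
Within n p q = p ≤ n + q × q ≤ n + p

∸-≤-suc-∸-suc : ∀ m k → m ∸ k ≤ suc (m ∸ suc k)
∸-≤-suc-∸-suc zero    zero    = z≤n
∸-≤-suc-∸-suc zero    (suc k) = z≤n
∸-≤-suc-∸-suc (suc m) zero    = ≤-refl
∸-≤-suc-∸-suc (suc m) (suc k) = ∸-≤-suc-∸-suc m k

pathDist-step : ∀ n p q k → Within 1 (pathDist n p q k) (pathDist n p q (suc k))
pathDist-step n p q k = down , up
  where
  down : (k + p) ⊓ ((n ∸ k) + q) ≤ suc (suc k + p) ⊓ suc ((n ∸ suc k) + q)
  down = ⊓-mono-≤ (≤-trans (n≤1+n _) (n≤1+n _)) (+-monoˡ-≤ q (∸-≤-suc-∸-suc n k))
  up : (suc k + p) ⊓ ((n ∸ suc k) + q) ≤ suc (k + p) ⊓ suc ((n ∸ k) + q)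
  up = ⊓-mono-≤ ≤-refl (+-monoˡ-≤ q (≤-trans (∸-monoʳ-≤ n (n≤1+n k)) (n≤1+n _)))

pathDist-start : ∀ n p q → p ≤ n + q → pathDist n p q 0 ≡ p
pathDist-start n p q p≤n+q = m≤n⇒m⊓n≡m p≤n+q

pathDist-end : ∀ n p q → q ≤ n + p → pathDist n p q n ≡ q
pathDist-end n p q q≤n+p rewrite n∸n≡0 n = m≥n⇒m⊓n≡n q≤n+p

every-vertex? : ∀ {P : V → Set} → (∀ x → Dec (P x)) → Dec (∀ x → P x)
every-vertex? P? =
  map′ (λ h → λ { (inj₁ a) → proj₁ h a ; (inj₂ (e , j)) → proj₂ h e j })
       (λ h → (λ a → h (inj₁ a)) , λ e j → h (inj₂ (e , j)))
       (all? (P? ∘ inj₁) ×-dec all? λ e → all? λ j → P? (inj₂ (e , j)))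

_≟V_ : DecidableEquality V
_≟V_ = Sum.≡-dec _≟_ (Product.≡-dec _≟_ _≟_)

tail<20 : ∀ e → tail e < 20
tail<20 = toWitness {a? = all? λ e → tail e <? 20} tt

head<20 : ∀ e → head e < 20
head<20 = toWitness {a? = all? λ e → head e <? 20} tt

tail-vertex head-vertex : Fin 30 → Fin 20
tail-vertex e = fromℕ< (tail<20 e)
head-vertex e = fromℕ< (head<20 e)

onEdge : Fin 30 → Fin 7 → V
onEdge e zero                                         = inj₁ (tail-vertex e)
onEdge e (suc zero)                                   = inj₂ (e , # 0)
onEdge e (suc (suc zero))                             = inj₂ (e , # 1)
onEdge e (suc (suc (suc zero)))                       = inj₂ (e , # 2)
onEdge e (suc (suc (suc (suc zero))))                 = inj₂ (e , # 3)
onEdge e (suc (suc (suc (suc (suc zero)))))           = inj₂ (e , # 4)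
onEdge e (suc (suc (suc (suc (suc (suc zero))))))     = inj₁ (head-vertex e)

-- An edge together with a direction of traversal (true: from tail to head).
Arc : Set
Arc = Fin 30 × Bool

destination : Arc → Fin 20
destination (e , true)  = head-vertex e
destination (e , false) = tail-vertex e

onArc : Arc → Fin 7 → V
onArc (e , true)  = onEdge e
onArc (e , false) = onEdge e ∘ opposite

onArc-end : ∀ a → onArc a (fromℕ 6) ≡ inj₁ (destination a)
onArc-end (e , true)  = refl
onArc-end (e , false) = refl

every-arc? : ∀ {P : Arc → Set} → (∀ a → Dec (P a)) → Dec (∀ a → P a)
every-arc? P? =
  map′ (λ h → λ { (e , true) → proj₁ (h e) ; (e , false) → proj₂ (h e) })
       (λ h e → h (e , true) , h (e , false))
       (all? λ e → P? (e , true) ×-dec P? (e , false))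

onArc-adjacent : ∀ a (k : Fin 6) → Adj (onArc a (inject₁ k)) (onArc a (suc k))
onArc-adjacent = toWitness {a? = every-arc? λ a → all? λ k → T? (adj (onArc a (inject₁ k)) (onArc a (suc k)))} tt

-- The three arcs leaving each branch vertex.
exitTable : Vec (Vec Arc 3) 20
exitTable =
  ((# 0 , true) ∷ (# 9 , false) ∷ (# 10 , true) ∷ []) ∷
  ((# 0 , false) ∷ (# 1 , true) ∷ (# 11 , true) ∷ []) ∷
  ((# 1 , false) ∷ (# 2 , true) ∷ (# 12 , true) ∷ []) ∷
  ((# 2 , false) ∷ (# 3 , true) ∷ (# 13 , true) ∷ []) ∷
  ((# 3 , false) ∷ (# 4 , true) ∷ (# 14 , true) ∷ []) ∷
  ((# 4 , false) ∷ (# 5 , true) ∷ (# 15 , true) ∷ []) ∷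
  ((# 5 , false) ∷ (# 6 , true) ∷ (# 16 , true) ∷ []) ∷
  ((# 6 , false) ∷ (# 7 , true) ∷ (# 17 , true) ∷ []) ∷
  ((# 7 , false) ∷ (# 8 , true) ∷ (# 18 , true) ∷ []) ∷
  ((# 8 , false) ∷ (# 9 , true) ∷ (# 19 , true) ∷ []) ∷
  ((# 10 , false) ∷ (# 20 , true) ∷ (# 28 , false) ∷ []) ∷
  ((# 11 , false) ∷ (# 21 , true) ∷ (# 29 , false) ∷ []) ∷
  ((# 12 , false) ∷ (# 20 , false) ∷ (# 22 , true) ∷ []) ∷
  ((# 13 , false) ∷ (# 21 , false) ∷ (# 23 , true) ∷ []) ∷
  ((# 14 , false) ∷ (# 22 , false) ∷ (# 24 , true) ∷ []) ∷
  ((# 15 , false) ∷ (# 23 , false) ∷ (# 25 , true) ∷ []) ∷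
  ((# 16 , false) ∷ (# 24 , false) ∷ (# 26 , true) ∷ []) ∷
  ((# 17 , false) ∷ (# 25 , false) ∷ (# 27 , true) ∷ []) ∷
  ((# 18 , false) ∷ (# 26 , false) ∷ (# 28 , true) ∷ []) ∷
  ((# 19 , false) ∷ (# 27 , false) ∷ (# 29 , true) ∷ []) ∷ []

exit : Fin 20 → Fin 3 → Arc
exit w i = lookup (lookup exitTable w) i

exit-starts : ∀ w i → onArc (exit w i) zero ≡ inj₁ w
exit-starts = toWitness {a? = all? λ w → all? λ i → onArc (exit w i) zero ≟V inj₁ w} tt

-- Graph distances of the dodecahedron in the numbering of dodecaEdges.
dodecaDistTable : Vec (Vec ℕ 20) 20
dodecaDistTable =
  (0 ∷ 1 ∷ 2 ∷ 3 ∷ 4 ∷ 5 ∷ 4 ∷ 3 ∷ 2 ∷ 1 ∷ 1 ∷ 2 ∷ 2 ∷ 3 ∷ 3 ∷ 4 ∷ 3 ∷ 3 ∷ 2 ∷ 2 ∷ []) ∷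
  (1 ∷ 0 ∷ 1 ∷ 2 ∷ 3 ∷ 4 ∷ 5 ∷ 4 ∷ 3 ∷ 2 ∷ 2 ∷ 1 ∷ 2 ∷ 2 ∷ 3 ∷ 3 ∷ 4 ∷ 3 ∷ 3 ∷ 2 ∷ []) ∷
  (2 ∷ 1 ∷ 0 ∷ 1 ∷ 2 ∷ 3 ∷ 4 ∷ 5 ∷ 4 ∷ 3 ∷ 2 ∷ 2 ∷ 1 ∷ 2 ∷ 2 ∷ 3 ∷ 3 ∷ 4 ∷ 3 ∷ 3 ∷ []) ∷
  (3 ∷ 2 ∷ 1 ∷ 0 ∷ 1 ∷ 2 ∷ 3 ∷ 4 ∷ 5 ∷ 4 ∷ 3 ∷ 2 ∷ 2 ∷ 1 ∷ 2 ∷ 2 ∷ 3 ∷ 3 ∷ 4 ∷ 3 ∷ []) ∷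
  (4 ∷ 3 ∷ 2 ∷ 1 ∷ 0 ∷ 1 ∷ 2 ∷ 3 ∷ 4 ∷ 5 ∷ 3 ∷ 3 ∷ 2 ∷ 2 ∷ 1 ∷ 2 ∷ 2 ∷ 3 ∷ 3 ∷ 4 ∷ []) ∷
  (5 ∷ 4 ∷ 3 ∷ 2 ∷ 1 ∷ 0 ∷ 1 ∷ 2 ∷ 3 ∷ 4 ∷ 4 ∷ 3 ∷ 3 ∷ 2 ∷ 2 ∷ 1 ∷ 2 ∷ 2 ∷ 3 ∷ 3 ∷ []) ∷
  (4 ∷ 5 ∷ 4 ∷ 3 ∷ 2 ∷ 1 ∷ 0 ∷ 1 ∷ 2 ∷ 3 ∷ 3 ∷ 4 ∷ 3 ∷ 3 ∷ 2 ∷ 2 ∷ 1 ∷ 2 ∷ 2 ∷ 3 ∷ []) ∷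
  (3 ∷ 4 ∷ 5 ∷ 4 ∷ 3 ∷ 2 ∷ 1 ∷ 0 ∷ 1 ∷ 2 ∷ 3 ∷ 3 ∷ 4 ∷ 3 ∷ 3 ∷ 2 ∷ 2 ∷ 1 ∷ 2 ∷ 2 ∷ []) ∷
  (2 ∷ 3 ∷ 4 ∷ 5 ∷ 4 ∷ 3 ∷ 2 ∷ 1 ∷ 0 ∷ 1 ∷ 2 ∷ 3 ∷ 3 ∷ 4 ∷ 3 ∷ 3 ∷ 2 ∷ 2 ∷ 1 ∷ 2 ∷ []) ∷
  (1 ∷ 2 ∷ 3 ∷ 4 ∷ 5 ∷ 4 ∷ 3 ∷ 2 ∷ 1 ∷ 0 ∷ 2 ∷ 2 ∷ 3 ∷ 3 ∷ 4 ∷ 3 ∷ 3 ∷ 2 ∷ 2 ∷ 1 ∷ []) ∷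
  (1 ∷ 2 ∷ 2 ∷ 3 ∷ 3 ∷ 4 ∷ 3 ∷ 3 ∷ 2 ∷ 2 ∷ 0 ∷ 3 ∷ 1 ∷ 4 ∷ 2 ∷ 5 ∷ 2 ∷ 4 ∷ 1 ∷ 3 ∷ []) ∷
  (2 ∷ 1 ∷ 2 ∷ 2 ∷ 3 ∷ 3 ∷ 4 ∷ 3 ∷ 3 ∷ 2 ∷ 3 ∷ 0 ∷ 3 ∷ 1 ∷ 4 ∷ 2 ∷ 5 ∷ 2 ∷ 4 ∷ 1 ∷ []) ∷
  (2 ∷ 2 ∷ 1 ∷ 2 ∷ 2 ∷ 3 ∷ 3 ∷ 4 ∷ 3 ∷ 3 ∷ 1 ∷ 3 ∷ 0 ∷ 3 ∷ 1 ∷ 4 ∷ 2 ∷ 5 ∷ 2 ∷ 4 ∷ []) ∷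
  (3 ∷ 2 ∷ 2 ∷ 1 ∷ 2 ∷ 2 ∷ 3 ∷ 3 ∷ 4 ∷ 3 ∷ 4 ∷ 1 ∷ 3 ∷ 0 ∷ 3 ∷ 1 ∷ 4 ∷ 2 ∷ 5 ∷ 2 ∷ []) ∷
  (3 ∷ 3 ∷ 2 ∷ 2 ∷ 1 ∷ 2 ∷ 2 ∷ 3 ∷ 3 ∷ 4 ∷ 2 ∷ 4 ∷ 1 ∷ 3 ∷ 0 ∷ 3 ∷ 1 ∷ 4 ∷ 2 ∷ 5 ∷ []) ∷
  (4 ∷ 3 ∷ 3 ∷ 2 ∷ 2 ∷ 1 ∷ 2 ∷ 2 ∷ 3 ∷ 3 ∷ 5 ∷ 2 ∷ 4 ∷ 1 ∷ 3 ∷ 0 ∷ 3 ∷ 1 ∷ 4 ∷ 2 ∷ []) ∷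
  (3 ∷ 4 ∷ 3 ∷ 3 ∷ 2 ∷ 2 ∷ 1 ∷ 2 ∷ 2 ∷ 3 ∷ 2 ∷ 5 ∷ 2 ∷ 4 ∷ 1 ∷ 3 ∷ 0 ∷ 3 ∷ 1 ∷ 4 ∷ []) ∷
  (3 ∷ 3 ∷ 4 ∷ 3 ∷ 3 ∷ 2 ∷ 2 ∷ 1 ∷ 2 ∷ 2 ∷ 4 ∷ 2 ∷ 5 ∷ 2 ∷ 4 ∷ 1 ∷ 3 ∷ 0 ∷ 3 ∷ 1 ∷ []) ∷
  (2 ∷ 3 ∷ 3 ∷ 4 ∷ 3 ∷ 3 ∷ 2 ∷ 2 ∷ 1 ∷ 2 ∷ 1 ∷ 4 ∷ 2 ∷ 5 ∷ 2 ∷ 4 ∷ 1 ∷ 3 ∷ 0 ∷ 3 ∷ []) ∷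
  (2 ∷ 2 ∷ 3 ∷ 3 ∷ 4 ∷ 3 ∷ 3 ∷ 2 ∷ 2 ∷ 1 ∷ 3 ∷ 1 ∷ 4 ∷ 2 ∷ 5 ∷ 2 ∷ 4 ∷ 1 ∷ 3 ∷ 0 ∷ []) ∷ []

dodecaDist : Fin 20 → Fin 20 → ℕ
dodecaDist a b = lookup (lookup dodecaDistTable a) b

-- The distance in D₅ to the branch vertex v: a path vertex is reached
-- through one of the two ends of its path.
branchDist : V → Fin 20 → ℕ
branchDist (inj₁ a) v = 6 * dodecaDist a v
branchDist (inj₂ (e , j)) v =
  pathDist 6 (6 * dodecaDist (tail-vertex e) v) (6 * dodecaDist (head-vertex e) v) (suc (toℕ j))

edge-within : ∀ e v → Within 6 (branchDist (inj₁ (tail-vertex e)) v) (branchDist (inj₁ (head-vertex e)) v)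
edge-within = toWitness {a? = all? λ e → all? λ v →
  let p = branchDist (inj₁ (tail-vertex e)) v ; q = branchDist (inj₁ (head-vertex e)) v
  in (p ≤? 6 + q) ×-dec (q ≤? 6 + p)} tt

data Link : V → V → Set where
  tail-link : ∀ e → Link (inj₁ (tail-vertex e)) (inj₂ (e , zero))
  head-link : ∀ e → Link (inj₁ (head-vertex e)) (inj₂ (e , # 4))
  path-link : ∀ e {j j'} → toℕ j' ≡ suc (toℕ j) → Link (inj₂ (e , j)) (inj₂ (e , j'))

==⇒≡ : ∀ {m n} → T (m == n) → m ≡ n
==⇒≡ {m} {n} = toWitness {a? = m ℕ.≟ n}

toℕ≡tail⇒≡tail-vertex : ∀ {a} e → toℕ a ≡ tail e → a ≡ tail-vertex e
toℕ≡tail⇒≡tail-vertex e eq = toℕ-injective (trans eq (sym (toℕ-fromℕ< (tail<20 e))))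

toℕ≡head⇒≡head-vertex : ∀ {a} e → toℕ a ≡ head e → a ≡ head-vertex e
toℕ≡head⇒≡head-vertex e eq = toℕ-injective (trans eq (sym (toℕ-fromℕ< (head<20 e))))

branch-path-link : ∀ {a e j} → Adj (inj₁ a) (inj₂ (e , j)) → Link (inj₁ a) (inj₂ (e , j))
branch-path-link {e = e} h with to T-∨ h
... | inj₁ atTail =
  let j≡0 , a≡tail = to T-∧ atTail
  in subst₂ (λ a j → Link (inj₁ a) (inj₂ (e , j)))
            (sym (toℕ≡tail⇒≡tail-vertex e (==⇒≡ a≡tail))) (sym (toℕ-injective {j = zero} (==⇒≡ j≡0)))
            (tail-link e)
... | inj₂ atHead =
  let j≡4 , a≡head = to T-∧ atHead
  in subst₂ (λ a j → Link (inj₁ a) (inj₂ (e , j)))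
            (sym (toℕ≡head⇒≡head-vertex e (==⇒≡ a≡head))) (sym (toℕ-injective {j = # 4} (==⇒≡ j≡4)))
            (head-link e)

adj⇒link : ∀ x y → Adj x y → Link x y ⊎ Link y x
adj⇒link (inj₁ a) (inj₁ b) ()
adj⇒link (inj₁ a) (inj₂ _) h = inj₁ (branch-path-link h)
adj⇒link (inj₂ _) (inj₁ a) h = inj₂ (branch-path-link h)
adj⇒link (inj₂ (e , j)) (inj₂ (e' , j')) h with e ≟ e'
... | yes refl = [ inj₁ ∘ path-link e ∘ ==⇒≡ , inj₂ ∘ path-link e ∘ ==⇒≡ ]′ (to T-∨ h)
... | no _     = ⊥-elim h

link-within : ∀ {x y} → Link x y → ∀ v → Within 1 (branchDist x v) (branchDist y v)
link-within (tail-link e) v =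
  subst (λ d → Within 1 d (branchDist (inj₂ (e , zero)) v))
        (pathDist-start 6 _ _ (proj₁ (edge-within e v))) (pathDist-step 6 _ _ 0)
link-within (head-link e) v =
  swap (subst (Within 1 (branchDist (inj₂ (e , # 4)) v))
              (pathDist-end 6 _ _ (proj₂ (edge-within e v))) (pathDist-step 6 _ _ 5))
link-within (path-link e {j} eq) v rewrite eq = pathDist-step 6 _ _ (suc (toℕ j))

step-within : ∀ {x y} → Step x y → ∀ v → Within 1 (branchDist x v) (branchDist y v)
step-within (inj₁ refl) v = n≤1+n _ , n≤1+n _
step-within {x} {y} (inj₂ h) v =
  [ (λ l → link-within l v) , (λ l → swap (link-within l v)) ]′ (adj⇒link x y h)

separated⇒DistAtLeast2 : ∀ v {r x} → 2 + branchDist r v ≤ branchDist x v → DistAtLeast2 r x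
separated⇒DistAtLeast2 v     sep zero          _              here          = 1+n≰n (≤-trans (n≤1+n _) sep)
separated⇒DistAtLeast2 v {r} sep (suc zero)    _              (step h here) =
  1+n≰n (≤-trans sep (proj₂ (step-within {r} (inj₂ h) v)))
separated⇒DistAtLeast2 v     sep (suc (suc n)) (s≤s (s≤s ())) _

onArc-approaches : ∀ a (k : Fin 6) →
  suc (branchDist (onArc a (suc k)) (destination a)) ≤ branchDist (onArc a (inject₁ k)) (destination a)
onArc-approaches = toWitness {a? = every-arc? λ a → all? λ k →
  suc (branchDist (onArc a (suc k)) (destination a)) ≤? branchDist (onArc a (inject₁ k)) (destination a)} tt

arc-length : ∀ a → branchDist (onArc a zero) (destination a) ≤ 6
arc-length = toWitness {a? = every-arc? λ a → branchDist (onArc a zero) (destination a) ≤? 6} tt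

far : ℕ → (Fin 3 → Fin 20) → V → Fin 3 → Bool
far d t x i = d ≤ᵇ branchDist x (t i)

escape : ℕ → (Fin 3 → Fin 20) → Cops → Fin 3
escape d t (x , y) = search λ i → far d t x i ∧ far d t y i

escape-far : ∀ d t x y → AtMostOneFailure (far d t x) → AtMostOneFailure (far d t y) →
             let i = escape d t (x , y) in d ≤ branchDist x (t i) × d ≤ branchDist y (t i)
escape-far d t x y hx hy =
  let fx , fy = to T-∧ (search-sound _ (map₂ (from T-∧) (commonSuccess hx hy)))
  in ≤ᵇ⇒≤ d _ fx , ≤ᵇ⇒≤ d _ fy

exits-escapable : ∀ w x → 3 ≤ branchDist x w → AtMostOneFailure (far 9 (destination ∘ exit w) x)
exits-escapable = toWitness {a? = all? λ w → every-vertex? λ x →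
  (3 ≤? branchDist x w) →-dec atMostOneFailure? (far 9 (destination ∘ exit w) x)} tt

corner : Fin 3 → Fin 20
corner i = i ↑ˡ 17

-- The corners 0, 1, 2 are pairwise at distance at least 6, so no vertex is
-- within distance 2 of two of them.
corners-escapable : ∀ x → AtMostOneFailure (far 3 corner x)
corners-escapable = toWitness {a? = every-vertex? λ x → atMostOneFailure? (far 3 corner x)} tt

-- The robber has taken k steps along the arc.
State : Set
State = Arc × Fin 6

position nextPosition : State → V
position     (a , k) = onArc a (inject₁ k)
nextPosition (a , k) = onArc a (suc k)

heading : State → Fin 20
heading (a , _) = destination a

enter : Fin 20 → Cops → State
enter w cops = exit w (escape 9 (destination ∘ exit w) cops) , zero

start : Cops → State
start cops = enter (corner (escape 3 corner cops)) cops

advance : State → Cops → State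
advance (a , k) cops with view k
... | ‵fromℕ     = enter (destination a) cops
... | ‵inject₁ j = a , suc j

state-adjacent : ∀ s → Adj (position s) (nextPosition s)
state-adjacent (a , k) = onArc-adjacent a k

advance-position : ∀ s cops → position (advance s cops) ≡ nextPosition s
advance-position (a , k) cops with view k
... | ‵fromℕ     = trans (exit-starts (destination a) _) (sym (onArc-end a))
... | ‵inject₁ j = refl

Ahead : ℕ → State → V → Set
Ahead m s x = m + branchDist (position s) (heading s) ≤ branchDist x (heading s)

AheadOfBoth : ℕ → State → Cops → Set
AheadOfBoth m s (x , y) = Ahead m s x × Ahead m s y

ahead-safe : ∀ s cops → AheadOfBoth 2 s cops → SafeFromCops (position s) cops
ahead-safe s (x , y) (hx , hy) =
  separated⇒DistAtLeast2 (heading s) hx , separated⇒DistAtLeast2 (heading s) hy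

ahead-weaken : ∀ {m} s cops → AheadOfBoth (suc m) s cops → AheadOfBoth m s cops
ahead-weaken s (x , y) (hx , hy) = ≤-trans (n≤1+n _) hx , ≤-trans (n≤1+n _) hy

ahead-move : ∀ {m} s {x x'} → Ahead (suc m) s x → Step x x' → Ahead m s x'
ahead-move s h st = ≤-pred (≤-trans h (proj₁ (step-within st (heading s))))

ahead-moves : ∀ {m} s cops cops' → AheadOfBoth (suc m) s cops →
              Step (proj₁ cops) (proj₁ cops') × Step (proj₂ cops) (proj₂ cops') → AheadOfBoth m s cops'
ahead-moves s _ _ (hx , hy) (sx , sy) = ahead-move s hx sx , ahead-move s hy sy

enter-ahead : ∀ w x y → 3 ≤ branchDist x w → 3 ≤ branchDist y w → AheadOfBoth 3 (enter w (x , y)) (x , y)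
enter-ahead w x y hx hy =
  let fx , fy = escape-far 9 (destination ∘ exit w) x y (exits-escapable w x hx) (exits-escapable w y hy)
      a = proj₁ (enter w (x , y))
  in ≤-trans (+-monoʳ-≤ 3 (arc-length a)) fx , ≤-trans (+-monoʳ-≤ 3 (arc-length a)) fy

start-ahead : ∀ cops → AheadOfBoth 3 (start cops) cops
start-ahead (x , y) =
  let fx , fy = escape-far 3 corner x y (corners-escapable x) (corners-escapable y)
  in enter-ahead _ x y fx fy

advance-ahead : ∀ s cops → AheadOfBoth 2 s cops → AheadOfBoth 3 (advance s cops) cops
advance-ahead (a , k) (x , y) (hx , hy) with view k
... | ‵fromℕ     = enter-ahead (destination a) x y (arrived x hx) (arrived y hy)
  where
  arrived : ∀ z → Ahead 2 (a , fromℕ 5) z → 3 ≤ branchDist z (destination a)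
  arrived z h = ≤-trans (+-monoʳ-≤ 2 (≤-trans (s≤s z≤n) (onArc-approaches a (fromℕ 5)))) h
... | ‵inject₁ j = closer x hx , closer y hy
  where
  closer : ∀ z → Ahead 2 (a , inject₁ j) z → Ahead 3 (a , suc j) z
  closer z h = ≤-trans (+-monoʳ-≤ 2 (onArc-approaches a (inject₁ j))) h

play : (n : ℕ) → (Fin (suc n) → Cops) → State
play zero    h = start (h zero)
play (suc n) h = advance (play n (h ∘ inject₁)) (h (fromℕ (suc n)))

robber : RobberStrategy
robber = record
  { pos      = λ n h → position (play n (lookup h))
  ; announce = λ n h → nextPosition (play n (lookup h))
  }

stateAt : Cops-seq → ℕ → State
stateAt c zero    = start (c zero)
stateAt c (suc k) = advance (stateAt c k) (c (suc k))

play-stateAt : ∀ c n h → (∀ i → h i ≡ c (toℕ i)) → play n h ≡ stateAt c n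
play-stateAt c zero    h eq = cong start (eq zero)
play-stateAt c (suc n) h eq =
  cong₂ advance (play-stateAt c n (h ∘ inject₁) λ i → trans (eq (inject₁ i)) (cong c (toℕ-inject₁ i)))
                (trans (eq (fromℕ (suc n))) (cong c (toℕ-fromℕ (suc n))))

module _ (c : Cops-seq) where

  play-prefix : ∀ k → play k (lookup (prefix c k)) ≡ stateAt c k
  play-prefix k = play-stateAt c k _ (lookup∘tabulate _)

  announced-adjacent : ∀ k → Adj (robberAt robber c k) (announcedAt robber c k)
  announced-adjacent k =
    subst₂ Adj (cong position (sym (play-prefix k))) (cong nextPosition (sym (play-prefix k)))
               (state-adjacent (stateAt c k))

  follows-announcement : ∀ k → robberAt robber c (suc k) ≡ announcedAt robber c k
  follows-announcement k = begin
    position (play (suc k) (lookup (prefix c (suc k)))) ≡⟨ cong position (play-prefix (suc k)) ⟩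
    position (advance (stateAt c k) (c (suc k)))        ≡⟨ advance-position (stateAt c k) (c (suc k)) ⟩
    nextPosition (stateAt c k)                          ≡⟨ cong nextPosition (play-prefix k) ⟨
    nextPosition (play k (lookup (prefix c k)))         ∎
    where open ≡-Reasoning

  robber-legal : RobberLegal robber c
  robber-legal k = subst (Step _) (sym (follows-announcement k)) (inj₂ (announced-adjacent k))

  -- The robber never stays put and always announces his next vertex.
  robber-respects-announcements : RespectsAnnouncements robber c
  robber-respects-announcements k _ _ = announced-adjacent (suc k) , follows-announcement (suc k)

  module _ (legal : LegalCops c) where

    invariant : ∀ k → AheadOfBoth 3 (stateAt c k) (c k)
    invariant zero    = start-ahead (c zero)
    invariant (suc k) =
      advance-ahead (stateAt c k) (c (suc k)) (ahead-moves (stateAt c k) (c k) (c (suc k)) (invariant k) (legal k))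

    robber-safe : AlwaysSafe robber c
    robber-safe k = subst (λ r → SafeFromCops r (c k) × SafeFromCops r (c (suc k)))
                          (cong position (sym (play-prefix k)))
                          ( ahead-safe s (c k) (ahead-weaken s (c k) (invariant k))
                          , ahead-safe s (c (suc k)) (ahead-moves s (c k) (c (suc k)) (invariant k) (legal k)))
      where s = stateAt c k

lemma4 : Σ RobberStrategy (λ σ → ∀ (c : Cops-seq) → LegalCops c →
           RobberLegal σ c × AlwaysSafe σ c × RespectsAnnouncements σ c)
lemma4 = robber , λ c legal → robber-legal c , robber-safe c legal , robber-respects-announcements c
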